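{- First-order arithmetic in ${\sf RT}(\mathcal S)$ coincides with first-order arithmetic in Set: a sentence of first-order arithmetic, interpreted in the natural numbers object $N$ of ${\sf RT}(\mathcal S)$, is true in ${\sf RT}(\mathcal S)$ if and only if it is true in the standard model $\mathbb N$.
   Context: $\mathcal S$ is Scott's graph model $\mathcal P(\mathbb N)$ with application $UV=\{n\mid \exists m\,(e_m\subseteq V\wedge\langle m,n\rangle\in U)\}$ ($e_m$ the finite set with $m=\sum_{k\in e_m}2^k$, $\langle\cdot,\cdot\rangle$ a fixed pairing bijection), and ${\sf RT}(\mathcal S)$ is the realizability topos over $\mathcal S$, with natural numbers object $N$; truth in the topos is given by realizability over $\mathcal S$. -}

module Defs where

open import Level using (0ℓ) renaming (suc to lsuc)
open import Data.Nat using (ℕ; zero; suc; _+_; _*_)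
open import Data.Nat.DivMod using (_/_; _%_)
open import Data.Fin using (Fin)
open import Data.Product using (Σ; _×_; uncurry)
open import Data.Sum using (_⊎_)
open import Data.Empty using (⊥)
open import Relation.Binary.PropositionalEquality using (_≡_)
open import Function.Definitions using (Bijective)

-- subsets of ℕ (arbitrary, not necessarily decidable: the elements of P(ℕ))
Subset : Set₁
Subset = ℕ → Set

IsPairing : (ℕ → ℕ → ℕ) → Set
IsPairing pair = Bijective _≡_ _≡_ (uncurry pair)

bit : ℕ → ℕ → ℕ
bit m zero    = m % 2
bit m (suc k) = bit (m / 2) k

-- e_m : the finite set with m = Σ_{k ∈ e_m} 2^k
e : ℕ → Subset
e m k = bit m k ≡ 1

_⊆_ : Subset → Subset → Set
A ⊆ B = ∀ k → A k → B k

app : (ℕ → ℕ → ℕ) → Subset → Subset → Subset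
app pair U V n = Σ ℕ λ m → (e m ⊆ V) × U (pair m n)

-- singleton {n}: the realizer of the natural number n (E(n) = {{n}})
sing : ℕ → Subset
sing n k = k ≡ n

-- components of an encoded pair of sets  {2n | n ∈ A} ∪ {2n+1 | n ∈ B}
fstS : Subset → Subset
fstS A n = A (2 * n)

sndS : Subset → Subset
sndS A n = A (suc (2 * n))

data Term (n : ℕ) : Set where
  var  : Fin n → Term n
  zer  : Term n
  succ : Term n → Term n
  _⊕_  : Term n → Term n → Term n
  _⊗_  : Term n → Term n → Term n

data Formula (n : ℕ) : Set where
  _≐_  : Term n → Term n → Formula n
  falsum : Formula n
  _∧'_ _∨'_ _⇒'_ : Formula n → Formula n → Formula n
  all' ex' : Formula (suc n) → Formula n

Sentence : Set
Sentence = Formula 0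

Env : ℕ → Set
Env n = Fin n → ℕ

extend : ∀ {n} → Env n → ℕ → Env (suc n)
extend ρ a Fin.zero    = a
extend ρ a (Fin.suc i) = ρ i

evalT : ∀ {n} → Env n → Term n → ℕ
evalT ρ (var i)  = ρ i
evalT ρ zer      = 0
evalT ρ (succ t) = suc (evalT ρ t)
evalT ρ (t ⊕ s)  = evalT ρ t + evalT ρ s
evalT ρ (t ⊗ s)  = evalT ρ t * evalT ρ s

⟦_⟧ℕ : ∀ {n} → Formula n → Env n → Set
⟦ t ≐ s ⟧ℕ ρ  = evalT ρ t ≡ evalT ρ s
⟦ falsum ⟧ℕ ρ = ⊥
⟦ φ ∧' ψ ⟧ℕ ρ = ⟦ φ ⟧ℕ ρ × ⟦ ψ ⟧ℕ ρ
⟦ φ ∨' ψ ⟧ℕ ρ = ⟦ φ ⟧ℕ ρ ⊎ ⟦ ψ ⟧ℕ ρ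
⟦ φ ⇒' ψ ⟧ℕ ρ = ⟦ φ ⟧ℕ ρ → ⟦ ψ ⟧ℕ ρ
⟦ all' φ ⟧ℕ ρ = (a : ℕ) → ⟦ φ ⟧ℕ (extend ρ a)
⟦ ex' φ ⟧ℕ ρ  = Σ ℕ λ a → ⟦ φ ⟧ℕ (extend ρ a)

TrueInℕ : Sentence → Set
TrueInℕ φ = ⟦ φ ⟧ℕ (λ ())

-- Realizability over S, i.e. the interpretation of arithmetic in the
-- natural numbers object N of RT(S) (N = (ℕ, n ↦ {{n}})).
Realizes : (ℕ → ℕ → ℕ) → ∀ {n} → Subset → Formula n → Env n → Set₁
Realizes pair A (t ≐ s) ρ  = Level.Lift (lsuc 0ℓ) (evalT ρ t ≡ evalT ρ s)
Realizes pair A falsum ρ   = Level.Lift (lsuc 0ℓ) ⊥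
Realizes pair A (φ ∧' ψ) ρ = Realizes pair (fstS A) φ ρ × Realizes pair (sndS A) ψ ρ
Realizes pair A (φ ∨' ψ) ρ =
  (Level.Lift (lsuc 0ℓ) (fstS A 0) × Realizes pair (sndS A) φ ρ)
  ⊎ (Level.Lift (lsuc 0ℓ) (∀ k → fstS A k → ⊥) × Realizes pair (sndS A) ψ ρ)
Realizes pair A (φ ⇒' ψ) ρ = (B : Subset) → Realizes pair B φ ρ → Realizes pair (app pair A B) ψ ρ
Realizes pair A (all' φ) ρ = (a : ℕ) → Realizes pair (app pair A (sing a)) φ (extend ρ a)
Realizes pair A (ex' φ) ρ  = Σ ℕ λ a →
  Level.Lift (lsuc 0ℓ) ((∀ k → fstS A k → k ≡ a) × fstS A a) × Realizes pair (sndS A) φ (extend ρ a)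

TrueInRT : (ℕ → ℕ → ℕ) → Sentence → Set₁
TrueInRT pair φ = Σ Subset λ A → Realizes pair A φ (λ ())

{-# OPTIONS --safe #-}
module Submission where

-- With excluded middle, a formula with parameters is realized iff it is true in ℕ,
-- by a simultaneous induction on formulas. Realizers of ∧, ∨ and ∃ are built by
-- interleaving sets (plus a tag or the witness), and realizability depends on the
-- realizer only up to extensional equality. A realizer of ∀x φ is the graph
-- {⟨2^a, n⟩ | n ∈ A_a} of realizers A_a of φ(a), since e_{2^a} is the only nonempty
-- finite subset of {a}. A realizer of φ ⇒ ψ with φ true is {⟨0, n⟩ | n ∈ B} for a
-- realizer B of ψ, since e_0 = ∅ lies in every argument; with φ false, soundness
-- shows φ has no realizer, so every set realizes φ ⇒ ψ.

open import Defs
open import Level using (0ℓ; lift) renaming (suc to lsuc)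
open import Axiom.ExcludedMiddle using (ExcludedMiddle)
open import Function using (_∘_; id)
open import Function.Bundles using (_⇔_; mk⇔)
open import Data.Nat using (ℕ; zero; suc; _*_; _^_)
open import Data.Nat.Properties using (*-comm; *-suc)
open import Data.Nat.DivMod using (_/_; _%_; m*n/n≡m; m*n%n≡0)
open import Data.Product using (Σ; _×_; _,_; proj₁; proj₂; swap)
open import Data.Product.Properties using (,-injective)
open import Data.Sum using (inj₁; inj₂)
open import Data.Unit using (tt)
open import Data.Empty using (⊥-elim)
open import Relation.Nullary using (yes; no)
open import Relation.Unary using (∅; U; _≐′_)
open import Relation.Binary.PropositionalEquality
  using (_≡_; refl; sym; trans; cong; subst; _≗_)

≗⇒≐′ : {A B : Subset} → A ≗ B → A ≐′ B
≗⇒≐′ A≗B = (λ n → subst id (A≗B n)) , (λ n → subst id (sym (A≗B n)))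

reindex-≐′ : {A B : Subset} (f : ℕ → ℕ) → A ≐′ B → (A ∘ f) ≐′ (B ∘ f)
reindex-≐′ f (A⊆B , B⊆A) = A⊆B ∘ f , B⊆A ∘ f

bit-0 : ∀ k → bit 0 k ≡ 0
bit-0 zero    = refl
bit-0 (suc k) = bit-0 k

bit-double-zero : ∀ m → bit (2 * m) zero ≡ 0
bit-double-zero m = trans (cong (_% 2) (*-comm 2 m)) (m*n%n≡0 m 2)

bit-double-suc : ∀ m k → bit (2 * m) (suc k) ≡ bit m k
bit-double-suc m k = cong (λ m′ → bit m′ k) (trans (cong (_/ 2) (*-comm 2 m)) (m*n/n≡m m 2))

e[0]⊆ : ∀ B → e 0 ⊆ B
e[0]⊆ B k 0∈e₀ with () ← trans (sym (bit-0 k)) 0∈e₀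

a∈e[2^a] : ∀ a → e (2 ^ a) a
a∈e[2^a] zero    = refl
a∈e[2^a] (suc a) = trans (bit-double-suc (2 ^ a) a) (a∈e[2^a] a)

e[2^a]⊆sing : ∀ a → e (2 ^ a) ⊆ sing a
e[2^a]⊆sing zero    zero    _ = refl
e[2^a]⊆sing zero    (suc k) k∈e with () ← trans (sym (bit-0 k)) k∈e
e[2^a]⊆sing (suc a) zero    k∈e with () ← trans (sym (bit-double-zero (2 ^ a))) k∈e
e[2^a]⊆sing (suc a) (suc k) k∈e =
  cong suc (e[2^a]⊆sing a k (trans (sym (bit-double-suc (2 ^ a) k)) k∈e))

pairS : Subset → Subset → Subset
pairS B C zero          = B 0
pairS B C (suc zero)    = C 0
pairS B C (suc (suc k)) = pairS (B ∘ suc) (C ∘ suc) k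

fstS-pairS : ∀ B C → fstS (pairS B C) ≗ B
fstS-pairS B C zero    = refl
fstS-pairS B C (suc n) = trans (cong (pairS B C) (*-suc 2 n)) (fstS-pairS (B ∘ suc) (C ∘ suc) n)

sndS-pairS : ∀ B C → sndS (pairS B C) ≗ C
sndS-pairS B C zero    = refl
sndS-pairS B C (suc n) =
  trans (cong (pairS B C ∘ suc) (*-suc 2 n)) (sndS-pairS (B ∘ suc) (C ∘ suc) n)

module Realizability (pair : ℕ → ℕ → ℕ) where

  app-respˡ-≐′ : ∀ {A B} C → A ≐′ B → app pair A C ≐′ app pair B C
  app-respˡ-≐′ C (A⊆B , B⊆A) =
    (λ { n (m , eₘ⊆C , ⟨m,n⟩∈A) → m , eₘ⊆C , A⊆B (pair m n) ⟨m,n⟩∈A }) ,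
    (λ { n (m , eₘ⊆C , ⟨m,n⟩∈B) → m , eₘ⊆C , B⊆A (pair m n) ⟨m,n⟩∈B })

  Realizes-resp-≐′ : ∀ {n} (φ : Formula n) ρ {A B} → A ≐′ B →
                     Realizes pair A φ ρ → Realizes pair B φ ρ
  Realizes-resp-≐′ (t ≐ s) ρ _ r = r
  Realizes-resp-≐′ falsum  ρ _ r = r
  Realizes-resp-≐′ (φ ∧' ψ) ρ A≐B (rφ , rψ) =
    Realizes-resp-≐′ φ ρ (reindex-≐′ (2 *_) A≐B) rφ ,
    Realizes-resp-≐′ ψ ρ (reindex-≐′ (suc ∘ (2 *_)) A≐B) rψ
  Realizes-resp-≐′ (φ ∨' ψ) ρ A≐B (inj₁ (lift tag , rφ)) =
    inj₁ (lift (proj₁ A≐B 0 tag) , Realizes-resp-≐′ φ ρ (reindex-≐′ (suc ∘ (2 *_)) A≐B) rφ)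
  Realizes-resp-≐′ (φ ∨' ψ) ρ A≐B (inj₂ (lift untagged , rψ)) =
    inj₂ (lift (λ k → untagged k ∘ proj₂ A≐B (2 * k)) ,
          Realizes-resp-≐′ ψ ρ (reindex-≐′ (suc ∘ (2 *_)) A≐B) rψ)
  Realizes-resp-≐′ (φ ⇒' ψ) ρ A≐B r C rφ =
    Realizes-resp-≐′ ψ ρ (app-respˡ-≐′ C A≐B) (r C rφ)
  Realizes-resp-≐′ (all' φ) ρ A≐B r a =
    Realizes-resp-≐′ φ _ (app-respˡ-≐′ (sing a) A≐B) (r a)
  Realizes-resp-≐′ (ex' φ) ρ A≐B (a , lift (unique , witness) , rφ) =
    a , lift ((λ k → unique k ∘ proj₂ A≐B (2 * k)) , proj₁ A≐B (2 * a) witness) ,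
    Realizes-resp-≐′ φ _ (reindex-≐′ (suc ∘ (2 *_)) A≐B) rφ

  module _ (pair-injective : ∀ {m n m′ n′} → pair m n ≡ pair m′ n′ → m ≡ m′ × n ≡ n′) where

    const : Subset → Subset
    const C k = Σ ℕ λ n → k ≡ pair 0 n × C n

    app-const : ∀ C B → app pair (const C) B ≐′ C
    app-const C B =
      (λ { n (_ , _ , n′ , eq , n′∈C) → subst C (sym (proj₂ (pair-injective eq))) n′∈C }) ,
      (λ n n∈C → 0 , e[0]⊆ B , n , refl , n∈C)

    graph : (ℕ → Subset) → Subset
    graph G k = Σ ℕ λ a → Σ ℕ λ n → k ≡ pair (2 ^ a) n × G a n

    app-graph-sing : ∀ G a → app pair (graph G) (sing a) ≐′ G a
    app-graph-sing G a = app-graph⊆ , λ n n∈Gₐ → 2 ^ a , e[2^a]⊆sing a , a , n , refl , n∈Gₐ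
      where
      app-graph⊆ : ∀ n → app pair (graph G) (sing a) n → G a n
      app-graph⊆ n (m , eₘ⊆a , a′ , n′ , eq , n′∈Gₐ′)
        with refl , refl ← pair-injective eq
        with refl ← eₘ⊆a a′ (a∈e[2^a] a′) = n′∈Gₐ′

    module _ (em : ExcludedMiddle 0ℓ) where

      Realizes⇒⟦⟧ℕ : ∀ {n} (φ : Formula n) ρ {A} → Realizes pair A φ ρ → ⟦ φ ⟧ℕ ρ
      ⟦⟧ℕ⇒Realizes : ∀ {n} (φ : Formula n) ρ → ⟦ φ ⟧ℕ ρ → Σ Subset λ A → Realizes pair A φ ρ

      Realizes⇒⟦⟧ℕ (t ≐ s)  ρ (lift t≡s)           = t≡s
      Realizes⇒⟦⟧ℕ falsum   ρ (lift ())
      Realizes⇒⟦⟧ℕ (φ ∧' ψ) ρ (rφ , rψ)            = Realizes⇒⟦⟧ℕ φ ρ rφ , Realizes⇒⟦⟧ℕ ψ ρ rψ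
      Realizes⇒⟦⟧ℕ (φ ∨' ψ) ρ (inj₁ (_ , rφ))      = inj₁ (Realizes⇒⟦⟧ℕ φ ρ rφ)
      Realizes⇒⟦⟧ℕ (φ ∨' ψ) ρ (inj₂ (_ , rψ))      = inj₂ (Realizes⇒⟦⟧ℕ ψ ρ rψ)
      Realizes⇒⟦⟧ℕ (φ ⇒' ψ) ρ r ⟦φ⟧                =
        let B , rφ = ⟦⟧ℕ⇒Realizes φ ρ ⟦φ⟧ in Realizes⇒⟦⟧ℕ ψ ρ (r B rφ)
      Realizes⇒⟦⟧ℕ (all' φ) ρ r a                  = Realizes⇒⟦⟧ℕ φ _ (r a)
      Realizes⇒⟦⟧ℕ (ex' φ)  ρ (a , _ , rφ)         = a , Realizes⇒⟦⟧ℕ φ _ rφ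

      ⟦⟧ℕ⇒Realizes (t ≐ s)  ρ t≡s = ∅ , lift t≡s
      ⟦⟧ℕ⇒Realizes falsum   ρ ()
      ⟦⟧ℕ⇒Realizes (φ ∧' ψ) ρ (⟦φ⟧ , ⟦ψ⟧) =
        let B , rφ = ⟦⟧ℕ⇒Realizes φ ρ ⟦φ⟧
            C , rψ = ⟦⟧ℕ⇒Realizes ψ ρ ⟦ψ⟧
        in pairS B C ,
           Realizes-resp-≐′ φ ρ (swap (≗⇒≐′ (fstS-pairS B C))) rφ ,
           Realizes-resp-≐′ ψ ρ (swap (≗⇒≐′ (sndS-pairS B C))) rψ
      ⟦⟧ℕ⇒Realizes (φ ∨' ψ) ρ (inj₁ ⟦φ⟧) =
        let B , rφ = ⟦⟧ℕ⇒Realizes φ ρ ⟦φ⟧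
        in pairS U B , inj₁ (lift tt , Realizes-resp-≐′ φ ρ (swap (≗⇒≐′ (sndS-pairS U B))) rφ)
      ⟦⟧ℕ⇒Realizes (φ ∨' ψ) ρ (inj₂ ⟦ψ⟧) =
        let C , rψ = ⟦⟧ℕ⇒Realizes ψ ρ ⟦ψ⟧
        in pairS ∅ C ,
           inj₂ (lift (proj₁ (≗⇒≐′ (fstS-pairS ∅ C))) ,
                 Realizes-resp-≐′ ψ ρ (swap (≗⇒≐′ (sndS-pairS ∅ C))) rψ)
      ⟦⟧ℕ⇒Realizes (φ ⇒' ψ) ρ ⟦φ⇒ψ⟧ with em {⟦ φ ⟧ℕ ρ}
      ... | yes ⟦φ⟧ =
        let C , rψ = ⟦⟧ℕ⇒Realizes ψ ρ (⟦φ⇒ψ⟧ ⟦φ⟧)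
        in const C , λ B _ → Realizes-resp-≐′ ψ ρ (swap (app-const C B)) rψ
      ... | no ¬⟦φ⟧ = ∅ , λ B rφ → ⊥-elim (¬⟦φ⟧ (Realizes⇒⟦⟧ℕ φ ρ rφ))
      ⟦⟧ℕ⇒Realizes (all' φ) ρ ⟦∀φ⟧ =
        graph (proj₁ ∘ realizer) , λ a →
          Realizes-resp-≐′ φ _ (swap (app-graph-sing (proj₁ ∘ realizer) a)) (proj₂ (realizer a))
        where
        realizer : (a : ℕ) → Σ Subset λ A → Realizes pair A φ (extend ρ a)
        realizer a = ⟦⟧ℕ⇒Realizes φ _ (⟦∀φ⟧ a)
      ⟦⟧ℕ⇒Realizes (ex' φ) ρ (a , ⟦φ⟧) =
        let C , rφ = ⟦⟧ℕ⇒Realizes φ _ ⟦φ⟧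
            fst≐a = ≗⇒≐′ (fstS-pairS (sing a) C)
        in pairS (sing a) C ,
           a , lift (proj₁ fst≐a , proj₂ fst≐a a refl) ,
           Realizes-resp-≐′ φ _ (swap (≗⇒≐′ (sndS-pairS (sing a) C))) rφ

open Realizability

-- Excluded middle is only ever applied to truth in ℕ, which lives in Set.
corollary4p7 : ExcludedMiddle 0ℓ → ExcludedMiddle (lsuc 0ℓ) →
    (pair : ℕ → ℕ → ℕ) → IsPairing pair →
    (φ : Sentence) → TrueInRT pair φ ⇔ Level.Lift (lsuc 0ℓ) (TrueInℕ φ)
corollary4p7 em _ pair isPairing φ =
  mk⇔ (λ (_ , r) → lift (Realizes⇒⟦⟧ℕ pair pair-injective em φ (λ ()) r))
      (λ (lift ⟦φ⟧) → ⟦⟧ℕ⇒Realizes pair pair-injective em φ (λ ()) ⟦φ⟧)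
  where
  pair-injective : ∀ {m n m′ n′} → pair m n ≡ pair m′ n′ → m ≡ m′ × n ≡ n′
  pair-injective = ,-injective ∘ proj₁ isPairing
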